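{- Let $G$ be a finite graph. There is a natural number $N$ such that, with $f:\mathbb{N}\to\mathbb{N}$ defined by $f(n)=\lceil N\log_2 n\rceil$, for all sufficiently large $n$ the probability that a uniformly random graph $H$ on the vertex set $\{1,\dots,n\}$ contains a $G$-free induced subgraph on $f(n)$ vertices is less than $n^{ -2f(n)}$.
   Context: A uniformly random graph on $\{1,\dots,n\}$ is one chosen uniformly among all $2^{\binom n2}$ graphs on these labelled vertices. A graph is $G$-free if it does not contain $G$ as an induced subgraph. "$H$ contains a $G$-free induced subgraph on $k$ vertices" means there is a $k$-element subset $S$ of the vertices such that the induced subgraph of $H$ on $S$ is $G$-free. -}

module Defs where

open import Data.Nat using (ℕ; zero; suc; _^_)
open import Data.Nat.Logarithm using (⌈log₂_⌉)
open import Data.Unit using (⊤)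
open import Data.Bool using (Bool; false)
open import Data.Vec using (Vec; lookup)
open import Data.Fin using (Fin; zero; suc)
open import Data.Fin.Subset using (Subset; _∈_; ∣_∣)
open import Data.Product using (_×_; _,_; ∃)
open import Function.Definitions using (Injective)
open import Relation.Binary.PropositionalEquality using (_≡_)
open import Relation.Nullary using (¬_)

-- Graph (suc n) = (adjacency of vertex zero to the vertices suc j , graph on the others).
-- First-order encoding of symmetric irreflexive adjacency relations; Graph n is in
-- bijection with the 2^(n C 2) labelled graphs on n vertices, and has decidable equality.
Graph : ℕ → Set
Graph zero    = ⊤
Graph (suc n) = Vec Bool n × Graph n

adj : ∀ {n} → Graph n → Fin n → Fin n → Bool
adj (v , g) zero    zero    = false
adj (v , g) zero    (suc j) = lookup v j
adj (v , g) (suc i) zero    = lookup v i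
adj (v , g) (suc i) (suc j) = adj g i j

InducedCopyIn : ∀ {m n} → Graph m → Graph n → Subset n → Set
InducedCopyIn {m} {n} G H S =
  ∃ λ (φ : Fin m → Fin n) →
    Injective _≡_ _≡_ φ × (∀ i → φ i ∈ S) × (∀ i j → adj H (φ i) (φ j) ≡ adj G i j)

HasGFreeInducedSubgraph : ∀ {m n} → Graph m → ℕ → Graph n → Set
HasGFreeInducedSubgraph G k H =
  ∃ λ S → ∣ S ∣ ≡ k × ¬ InducedCopyIn G H S

-- f(n) = ⌈ N log₂ n ⌉ = ⌈ log₂ (n ^ N) ⌉  (exact identity for n ≥ 1)
f : ℕ → ℕ → ℕ
f N n = ⌈log₂ (n ^ N) ⌉

-- A graph on n vertices is its n C 2 adjacency bits, so probabilities are counts of Boolean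
-- vectors. Take k = f N n distinct vertices σ, cut them into m blocks of m c slots with
-- c = k / (m² + 1), and for a, b < c let copy (a , b) put vertex i of G at slot a + i b of block i.
-- Two lines i ↦ a + i b meet at most once, so distinct copies share no pair of vertices: the c²
-- events "copy (a , b) induces G" fix disjoint sets of at most m² + 1 bits and are independent.
-- If σ spans a G-free induced subgraph all of them fail, which happens for at most a fraction
-- (1 - 2^-(m² + 1))^(c²) of the graphs. By Bernoulli's inequality this is at most 2^-(c² / 2^(m² + 1)),
-- and since c ≈ N log₂ n / (m² + 1) it beats the union bound over the n^k choices of σ together
-- with the n^(2 k) of the statement once N is large.

module Submission where

open import Defs
open import Data.Nat using (ℕ; _*_; _^_; _≥_; _<_)
open import Data.Nat.Combinatorics using (_C_)
open import Data.List using (List; length)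
open import Data.List.Relation.Unary.All using (All)
open import Data.List.Relation.Unary.Unique.Propositional using (Unique)
open import Data.Product using (∃)

open import Data.Bool using (Bool; true; false; if_then_else_; _∧_; _∨_; not)
open import Data.Empty using (⊥-elim)
open import Data.Fin using (Fin; zero; suc; toℕ; fromℕ<; inject≤; combine; remQuot; _↑ˡ_; _↑ʳ_; splitAt)
open import Data.Fin.Properties
  using (_≟_; all?; suc-injective; 0≢1+n; toℕ<n; toℕ-fromℕ<; toℕ-injective; inject≤-injective; remQuot-combine;
         splitAt-↑ˡ; splitAt-↑ʳ; ↑ˡ-injective; ↑ʳ-injective; injective⇒≤)
open import Data.Fin.Subset using (Subset; ∣_∣; inside; outside) renaming (_∈_ to _∈ₛ_)
open import Data.List using ([]; _∷_; map; filter; cartesianProduct; allFin)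
import Data.List as List
open import Data.List.Membership.Propositional using (_∈_)
open import Data.List.Membership.Propositional.Properties
  using (∈-lookup; ∈-map⁺; ∈-map⁻; ∈-filter⁺; ∈-filter⁻; ∈-cartesianProduct⁺; ∈-allFin)
open import Data.List.Properties using (length-map; length-filter; length-++; length-tabulate)
open import Data.List.Relation.Unary.All as All using ([]; _∷_)
import Data.List.Relation.Unary.All.Properties as All
open import Data.List.Relation.Unary.AllPairs as AllPairs using (AllPairs; []; _∷_)
import Data.List.Relation.Unary.AllPairs.Properties as AllPairs
open import Data.List.Relation.Unary.Any using (here; there)
import Data.List.Relation.Unary.Unique.Propositional.Properties as Unique
open import Data.Maybe using (Maybe; just; nothing)
open import Data.Nat using (zero; suc; _+_; _≤_; _∸_; z≤n; s≤s; NonZero; >-nonZero; _/_; _%_; _<?_)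
open import Data.Nat.Combinatorics using (nC1≡n; nCk+nC[k+1]≡[n+1]C[k+1])
open import Data.Nat.DivMod using (m≡m%n+[m/n]*n; m%n<n; m*n/n≡m; /-monoˡ-≤; m/n*n≤m)
open import Data.Nat.Logarithm using (⌈log₂_⌉; ⌈log₂⌉-mono-≤; ⌈log₂2^n⌉≡n)
open import Data.Nat.Properties hiding (_≟_; suc-injective; 0≢1+n)
open import Algebra.Properties.CommutativeSemigroup +-commutativeSemigroup
  using () renaming (interchange to +-interchange)
open import Algebra.Properties.CommutativeSemigroup *-commutativeSemigroup
  using (xy∙z≈xz∙y; xy∙z≈y∙xz; x∙yz≈y∙xz)
open import Data.Nat.Tactic.RingSolver using (solve-∀)
open import Data.Product using (_×_; _,_; proj₁; proj₂)
import Data.Product as Product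
open import Data.Product.Properties using (,-injective)
open import Data.Sum as Sum using (_⊎_; inj₁; inj₂; [_,_]′)
open import Data.Unit using (tt)
open import Data.Vec using (Vec; []; _∷_; lookup; _++_)
import Data.Vec as Vec
open import Data.Vec.Properties using (++-injective; lookup-++ˡ; lookup-++ʳ; lookup-map)
open import Function using (_∘_)
open import Function.Definitions using (Injective)
open import Relation.Binary.Definitions using (tri<; tri≈; tri>)
open import Relation.Binary.PropositionalEquality
open import Relation.Nullary using (Dec; yes; no; does; ¬?; contradiction)
open import Relation.Nullary.Decidable using (_→-dec_)

count : ∀ {D} → (Vec Bool D → Bool) → ℕ
count {zero}  p = if p [] then 1 else 0
count {suc D} p = count (p ∘ (true ∷_)) + count (p ∘ (false ∷_))

count-cong : ∀ {D} {p q : Vec Bool D → Bool} → (∀ x → p x ≡ q x) → count p ≡ count q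
count-cong {zero}  e rewrite e [] = refl
count-cong {suc D} e = cong₂ _+_ (count-cong (e ∘ (true ∷_))) (count-cong (e ∘ (false ∷_)))

count-false : ∀ {D} → count {D} (λ _ → false) ≡ 0
count-false {zero}  = refl
count-false {suc D} = cong₂ _+_ (count-false {D}) (count-false {D})

count≤2^D : ∀ {D} (p : Vec Bool D → Bool) → count p ≤ 2 ^ D
count≤2^D {zero} p with p []
... | true  = ≤-refl
... | false = z≤n
count≤2^D {suc D} p =
  ≤-trans (+-mono-≤ (count≤2^D (p ∘ (true ∷_))) (count≤2^D (p ∘ (false ∷_))))
          (≤-reflexive (cong (2 ^ D +_) (sym (+-identityʳ (2 ^ D)))))

count-split : ∀ {D} (q p : Vec Bool D → Bool) →
  count p ≡ count (λ x → q x ∧ p x) + count (λ x → not (q x) ∧ p x)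
count-split {zero} q p with q [] | p []
... | true  | true  = refl
... | true  | false = refl
... | false | true  = refl
... | false | false = refl
count-split {suc D} q p = begin
  count (p ∘ (true ∷_)) + count (p ∘ (false ∷_))
    ≡⟨ cong₂ _+_ (count-split (q ∘ (true ∷_)) (p ∘ (true ∷_))) (count-split (q ∘ (false ∷_)) (p ∘ (false ∷_))) ⟩
  (a + b) + (c + d) ≡⟨ +-interchange a b c d ⟩
  (a + c) + (b + d) ∎
  where
  open ≡-Reasoning
  a = count (λ x → q (true ∷ x) ∧ p (true ∷ x))
  b = count (λ x → not (q (true ∷ x)) ∧ p (true ∷ x))
  c = count (λ x → q (false ∷ x) ∧ p (false ∷ x))
  d = count (λ x → not (q (false ∷ x)) ∧ p (false ∷ x))

count-∨ : ∀ {D} (p q : Vec Bool D → Bool) → count (λ x → p x ∨ q x) ≤ count p + count q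
count-∨ {zero} p q with p [] | q []
... | true  | true  = s≤s z≤n
... | true  | false = ≤-refl
... | false | _     = ≤-refl
count-∨ {suc D} p q = begin
  count (λ x → p (true ∷ x) ∨ q (true ∷ x)) + count (λ x → p (false ∷ x) ∨ q (false ∷ x))
    ≤⟨ +-mono-≤ (count-∨ (p ∘ (true ∷_)) (q ∘ (true ∷_))) (count-∨ (p ∘ (false ∷_)) (q ∘ (false ∷_))) ⟩
  (a + b) + (c + d) ≡⟨ +-interchange a b c d ⟩
  (a + c) + (b + d) ∎
  where
  open ≤-Reasoning
  a = count (p ∘ (true ∷_))
  b = count (q ∘ (true ∷_))
  c = count (p ∘ (false ∷_))
  d = count (q ∘ (false ∷_))

index : ∀ {D} (p : Vec Bool D → Bool) x → p x ≡ true → Fin (count p)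
index {zero}  p []          px rewrite px = zero
index {suc D} p (true ∷ x)  px = index (p ∘ (true ∷_)) x px ↑ˡ _
index {suc D} p (false ∷ x) px = _ ↑ʳ index (p ∘ (false ∷_)) x px

↑ˡ≢↑ʳ : ∀ {m n} (i : Fin m) (j : Fin n) → i ↑ˡ n ≢ m ↑ʳ j
↑ˡ≢↑ʳ {m} {n} i j e with trans (sym (splitAt-↑ˡ m i n)) (trans (cong (splitAt m) e) (splitAt-↑ʳ m n j))
... | ()

index-injective : ∀ {D} (p : Vec Bool D → Bool) x y (px : p x ≡ true) (py : p y ≡ true) →
  index p x px ≡ index p y py → x ≡ y
index-injective {zero}  p []          []          _  _  _ = refl
index-injective {suc D} p (true ∷ x)  (true ∷ y)  px py e =
  cong (true ∷_) (index-injective _ x y px py (↑ˡ-injective _ _ _ e))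
index-injective {suc D} p (true ∷ x)  (false ∷ y) px py e = ⊥-elim (↑ˡ≢↑ʳ _ _ e)
index-injective {suc D} p (false ∷ x) (true ∷ y)  px py e = ⊥-elim (↑ˡ≢↑ʳ _ _ (sym e))
index-injective {suc D} p (false ∷ x) (false ∷ y) px py e =
  cong (false ∷_) (index-injective _ x y px py (↑ʳ-injective _ _ _ e))

Unique-lookup-injective : ∀ {A : Set} {xs : List A} → Unique xs →
  ∀ i j → List.lookup xs i ≡ List.lookup xs j → i ≡ j
Unique-lookup-injective (_ ∷ _)   zero    zero    _ = refl
Unique-lookup-injective (x∉ ∷ _)  zero    (suc j) e = ⊥-elim (All.lookup x∉ (∈-lookup j) e)
Unique-lookup-injective (x∉ ∷ _)  (suc i) zero    e = ⊥-elim (All.lookup x∉ (∈-lookup i) (sym e))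
Unique-lookup-injective (_ ∷ u)   (suc i) (suc j) e = cong suc (Unique-lookup-injective u i j e)

length≤count : ∀ {D} (p : Vec Bool D → Bool) (xs : List (Vec Bool D)) →
  Unique xs → All (λ x → p x ≡ true) xs → length xs ≤ count p
length≤count p xs unique sat = injective⇒≤ {f = indexOf}
  λ {i} {j} e → Unique-lookup-injective unique i j (index-injective p _ _ _ _ e)
  where
  indexOf : Fin (length xs) → Fin (count p)
  indexOf i = index p (List.lookup xs i) (All.lookup sat (∈-lookup i))

count-guard : ∀ {D} {P : Set} (d : Dec P) (q : Vec Bool D → Bool) {W V} →
  (P → count q * W ≤ V) → count (λ x → does d ∧ q x) * W ≤ V
count-guard {D} (no _)  q {W} _     = ≤-trans (≤-reflexive (cong (_* W) (count-false {D}))) z≤n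
count-guard     (yes p) q       bound = bound p

-- Constraints: partial assignments of bits

Constraint : ℕ → Set
Constraint D = Fin D → Maybe Bool

fixes : Maybe Bool → ℕ
fixes nothing  = 0
fixes (just _) = 1

size : ∀ {D} → Constraint D → ℕ
size {zero}  c = 0
size {suc D} c = fixes (c zero) + size (c ∘ suc)

agrees : Bool → Maybe Bool → Bool
agrees _     nothing  = true
agrees true  (just b) = b
agrees false (just b) = not b

matches : ∀ {D} → Constraint D → Vec Bool D → Bool
matches c []      = true
matches c (h ∷ x) = agrees h (c zero) ∧ matches (c ∘ suc) x

Disjoint : ∀ {D} → Constraint D → Constraint D → Set
Disjoint c d = ∀ i → c i ≡ nothing ⊎ d i ≡ nothing

Ignores : ∀ {D} → Constraint D → (Vec Bool D → Bool) → Set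
Ignores c p = ∀ x y → (∀ i → c i ≡ nothing → lookup x i ≡ lookup y i) → p x ≡ p y

avoidsAll : ∀ {D} → List (Constraint D) → Vec Bool D → Bool
avoidsAll []      x = true
avoidsAll (c ∷ F) x = not (matches c x) ∧ avoidsAll F x

matches-sound : ∀ {D} (c : Constraint D) x {i b} → matches c x ≡ true → c i ≡ just b → lookup x i ≡ b
matches-sound c (h ∷ x) {zero} cx ci with c zero | h
matches-sound c (h ∷ x) {zero} cx refl | just true  | true  = refl
matches-sound c (h ∷ x) {zero} cx refl | just false | false = refl
matches-sound c (h ∷ x) {zero} () refl | just true  | false
matches-sound c (h ∷ x) {zero} () refl | just false | true
matches-sound c (h ∷ x) {suc i} cx ci with agrees h (c zero)
... | true = matches-sound (c ∘ suc) x cx ci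

matches-local : ∀ {D} (c : Constraint D) x y →
  (∀ i → c i ≡ nothing ⊎ lookup x i ≡ lookup y i) → matches c x ≡ matches c y
matches-local c []      []      _     = refl
matches-local c (h ∷ x) (h′ ∷ y) agree with agree zero
... | inj₁ c0 rewrite c0 = matches-local (c ∘ suc) x y (agree ∘ suc)
... | inj₂ refl = cong (agrees h (c zero) ∧_) (matches-local (c ∘ suc) x y (agree ∘ suc))

ignores-tail : ∀ {D} {c : Constraint (suc D)} {p} h → Ignores c p → Ignores (c ∘ suc) (p ∘ (h ∷_))
ignores-tail h ign x y agree = ign (h ∷ x) (h ∷ y) λ { zero _ → refl ; (suc i) → agree i }

ignores-head : ∀ {D} {c : Constraint (suc D)} {p b} → Ignores c p → c zero ≡ just b →
  ∀ x → p (true ∷ x) ≡ p (false ∷ x)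
ignores-head {c = c} ign c0 x = ign _ _ λ { zero c0′ → just≢nothing (trans (sym c0) c0′) ; (suc i) _ → refl }
  where just≢nothing : ∀ {A : Set} {b : Bool} → just b ≡ nothing → A
        just≢nothing ()

doubling : ∀ A u {Z P} → Z ≡ 0 → A * u ≡ P → (A + Z) * (2 * u) ≡ P + P
doubling A u refl refl = rearrange A u
  where rearrange : ∀ A u → (A + 0) * (2 * u) ≡ A * u + A * u
        rearrange = solve-∀

count-matches : ∀ {D} (c : Constraint D) p → Ignores c p →
  count (λ x → matches c x ∧ p x) * 2 ^ size c ≡ count p
count-matches {zero}  c p ign = *-identityʳ _
count-matches {suc D} c p ign with c zero in c0
... | nothing = trans
  (*-distribʳ-+ (2 ^ size (c ∘ suc)) (count (λ x → matches (c ∘ suc) x ∧ p (true ∷ x)))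
                                    (count (λ x → matches (c ∘ suc) x ∧ p (false ∷ x))))
  (cong₂ _+_ (count-matches (c ∘ suc) _ (ignores-tail true ign))
             (count-matches (c ∘ suc) _ (ignores-tail false ign)))
... | just true = trans
  (doubling (count (λ x → matches (c ∘ suc) x ∧ p (true ∷ x))) (2 ^ size (c ∘ suc))
            (count-false {D}) (count-matches (c ∘ suc) _ (ignores-tail true ign)))
  (cong (count (p ∘ (true ∷_)) +_) (count-cong (ignores-head ign c0)))
... | just false = begin
  (count {D} (λ _ → false) + A) * (2 * 2 ^ s) ≡⟨ cong (_* (2 * 2 ^ s)) (+-comm (count {D} (λ _ → false)) A) ⟩
  (A + count {D} (λ _ → false)) * (2 * 2 ^ s)
    ≡⟨ doubling A (2 ^ s) (count-false {D}) (count-matches (c ∘ suc) _ (ignores-tail false ign)) ⟩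
  count (p ∘ (false ∷_)) + count (p ∘ (false ∷_))
    ≡⟨ cong (_+ count (p ∘ (false ∷_))) (count-cong (sym ∘ ignores-head ign c0)) ⟩
  count (p ∘ (true ∷_)) + count (p ∘ (false ∷_)) ∎
  where
  open ≡-Reasoning
  s = size (c ∘ suc)
  A = count (λ x → matches (c ∘ suc) x ∧ p (false ∷ x))

count-avoids : ∀ {D} (c : Constraint D) p → Ignores c p →
  count (λ x → not (matches c x) ∧ p x) * 2 ^ size c ≡ count p * (2 ^ size c ∸ 1)
count-avoids c p ign = begin
  B * u                 ≡⟨ m+n∸m≡n (A * u) (B * u) ⟨
  (A * u + B * u) ∸ A * u ≡⟨ cong₂ _∸_ (sym (*-distribʳ-+ u A B)) (count-matches c p ign) ⟩
  (A + B) * u ∸ count p ≡⟨ cong (λ z → z * u ∸ count p) (count-split (matches c) p) ⟨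
  count p * u ∸ count p ≡⟨ cong (count p * u ∸_) (*-identityʳ (count p)) ⟨
  count p * u ∸ count p * 1 ≡⟨ *-distribˡ-∸ (count p) u 1 ⟨
  count p * (u ∸ 1)     ∎
  where
  open ≡-Reasoning
  u = 2 ^ size c
  A = count (λ x → matches c x ∧ p x)
  B = count (λ x → not (matches c x) ∧ p x)

avoidsAll-ignores : ∀ {D} (c : Constraint D) F → All (Disjoint c) F → Ignores c (avoidsAll F)
avoidsAll-ignores c []      []                x y agree = refl
avoidsAll-ignores c (d ∷ F) (c#d ∷ c#F) x y agree = cong₂ _∧_
  (cong not (matches-local d x y λ i → Sum.swap (Sum.map₁ (agree i) (c#d i))))
  (avoidsAll-ignores c F c#F x y agree)

-- (1 - 2^-a) ≤ (1 - 2^-s) for a ≤ s, cleared of denominators.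
avoid-rate-mono : ∀ {a s} B P → a ≤ s → B * 2 ^ a ≡ P * (2 ^ a ∸ 1) → B * 2 ^ s ≤ P * (2 ^ s ∸ 1)
avoid-rate-mono {a} {s} B P a≤s eq = begin
  B * 2 ^ s             ≡⟨ cong (B *_) 2^s≡u*v ⟩
  B * (u * v)           ≡⟨ *-assoc B u v ⟨
  B * u * v             ≡⟨ cong (_* v) eq ⟩
  P * (u ∸ 1) * v       ≡⟨ *-assoc P (u ∸ 1) v ⟩
  P * ((u ∸ 1) * v)     ≡⟨ cong (P *_) (*-distribʳ-∸ v u 1) ⟩
  P * (u * v ∸ 1 * v)   ≤⟨ *-monoʳ-≤ P (∸-monoʳ-≤ (u * v) (≤-trans (m^n>0 2 (s ∸ a)) (≤-reflexive (sym (*-identityˡ v))))) ⟩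
  P * (u * v ∸ 1)       ≡⟨ cong (λ z → P * (z ∸ 1)) 2^s≡u*v ⟨
  P * (2 ^ s ∸ 1)       ∎
  where
  open ≤-Reasoning
  u = 2 ^ a
  v = 2 ^ (s ∸ a)
  2^s≡u*v : 2 ^ s ≡ u * v
  2^s≡u*v = trans (cong (2 ^_) (sym (m+[n∸m]≡n a≤s))) (^-distribˡ-+-* 2 a (s ∸ a))

count-avoidsAll : ∀ {D} s (F : List (Constraint D)) → AllPairs Disjoint F → All (λ c → size c ≤ s) F →
  count (avoidsAll F) * (2 ^ s) ^ length F ≤ 2 ^ D * (2 ^ s ∸ 1) ^ length F
count-avoidsAll {D} s [] [] [] = begin
  count {D} (λ _ → true) * 1 ≡⟨ *-identityʳ _ ⟩
  count {D} (λ _ → true)     ≤⟨ count≤2^D {D} (λ _ → true) ⟩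
  2 ^ D                      ≡⟨ *-identityʳ _ ⟨
  2 ^ D * 1                  ∎
  where open ≤-Reasoning
count-avoidsAll {D} s (c ∷ F) (c#F ∷ disjoint) (c≤s ∷ F≤s) = begin
  B * (M * M ^ t)               ≡⟨ *-assoc B M (M ^ t) ⟨
  B * M * M ^ t                 ≤⟨ *-monoˡ-≤ (M ^ t) (avoid-rate-mono B P c≤s
                                     (count-avoids c (avoidsAll F) (avoidsAll-ignores c F c#F))) ⟩
  P * (M ∸ 1) * M ^ t           ≡⟨ xy∙z≈y∙xz P (M ∸ 1) (M ^ t) ⟩
  (M ∸ 1) * (P * M ^ t)         ≤⟨ *-monoʳ-≤ (M ∸ 1) (count-avoidsAll s F disjoint F≤s) ⟩
  (M ∸ 1) * (2 ^ D * (M ∸ 1) ^ t) ≡⟨ x∙yz≈y∙xz (M ∸ 1) (2 ^ D) ((M ∸ 1) ^ t) ⟩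
  2 ^ D * ((M ∸ 1) * (M ∸ 1) ^ t) ∎
  where
  open ≤-Reasoning
  M = 2 ^ s
  t = length F
  B = count (avoidsAll (c ∷ F))
  P = count (avoidsAll F)

avoidsAll-intro : ∀ {D} (F : List (Constraint D)) x → All (λ c → matches c x ≡ false) F → avoidsAll F x ≡ true
avoidsAll-intro []      x []          = refl
avoidsAll-intro (c ∷ F) x (cx ∷ Fx) rewrite cx = avoidsAll-intro F x Fx

assignment : ∀ {D} → List (Fin D × Bool) → Constraint D
assignment []            i = nothing
assignment ((j , b) ∷ l) i = if does (j ≟ i) then just b else assignment l i

assignment-sound : ∀ {D} (l : List (Fin D × Bool)) {i b} → assignment l i ≡ just b → (i , b) ∈ l
assignment-sound ((j , b′) ∷ l) {i} eq with j ≟ i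
assignment-sound ((j , b′) ∷ l) refl | yes refl = here refl
... | no _ = there (assignment-sound l eq)

assignment-defined : ∀ {D} (l : List (Fin D × Bool)) {i b} → (i , b) ∈ l → ∃ λ b′ → assignment l i ≡ just b′
assignment-defined ((j , b′) ∷ l) {i} i∈ with j ≟ i | i∈
... | yes _ | _          = b′ , refl
... | no j≢i | here refl = ⊥-elim (j≢i refl)
... | no _  | there i∈l  = assignment-defined l i∈l

fixes≤1 : ∀ v → fixes v ≤ 1
fixes≤1 nothing  = z≤n
fixes≤1 (just _) = s≤s z≤n

size-mono : ∀ {D} (c d : Constraint D) → (∀ i → fixes (c i) ≤ fixes (d i)) → size c ≤ size d
size-mono {zero}  c d le = z≤n
size-mono {suc D} c d le = +-mono-≤ (le zero) (size-mono (c ∘ suc) (d ∘ suc) (le ∘ suc))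

size-except : ∀ {D} (c d : Constraint D) j → (∀ i → i ≢ j → fixes (c i) ≤ fixes (d i)) → size c ≤ suc (size d)
size-except {suc D} c d zero le =
  +-mono-≤ (fixes≤1 (c zero)) (≤-trans (size-mono (c ∘ suc) (d ∘ suc) (λ i → le (suc i) λ ())) (m≤n+m _ _))
size-except {suc D} c d (suc j) le = ≤-trans
  (+-mono-≤ (le zero λ ()) (size-except (c ∘ suc) (d ∘ suc) j (λ i i≢j → le (suc i) (i≢j ∘ suc-injective))))
  (≤-reflexive (+-suc _ _))

size-empty : ∀ {D} → size {D} (λ _ → nothing) ≡ 0
size-empty {zero}  = refl
size-empty {suc D} = size-empty {D}

size-assignment : ∀ {D} (l : List (Fin D × Bool)) → size (assignment l) ≤ length l
size-assignment {D} [] = ≤-reflexive (size-empty {D})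
size-assignment ((j , b) ∷ l) = ≤-trans (size-except _ (assignment l) j agree) (s≤s (size-assignment l))
  where agree : ∀ i → i ≢ j → fixes (assignment ((j , b) ∷ l) i) ≤ fixes (assignment l i)
        agree i i≢j with j ≟ i
        ... | yes refl = ⊥-elim (i≢j refl)
        ... | no _     = ≤-refl

-- Graphs as bit vectors

slots : ℕ → ℕ
slots zero    = 0
slots (suc n) = n + slots n

slots≡C2 : ∀ n → slots n ≡ n C 2
slots≡C2 zero    = refl
slots≡C2 (suc n) = trans (cong₂ _+_ (sym (nC1≡n n)) (slots≡C2 n)) (nCk+nC[k+1]≡[n+1]C[k+1] n 1)

-- The leading dummy bit is where pos sends the diagonal, so that adjacency is a total lookup.
encode : ∀ {n} → Graph n → Vec Bool (suc (slots n))
encode H = false ∷ bits H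
  where
  bits : ∀ {n} → Graph n → Vec Bool (slots n)
  bits {zero}  _       = []
  bits {suc n} (v , g) = v ++ bits g

encode-injective : ∀ {n} (H H′ : Graph n) → encode H ≡ encode H′ → H ≡ H′
encode-injective {zero}  tt      tt        _ = refl
encode-injective {suc n} (v , g) (v′ , g′) e with ++-injective v v′ (cong Vec.tail e)
... | refl , e′ = cong (v ,_) (encode-injective g g′ (cong (false ∷_) e′))

shift : ∀ n → Fin (suc (slots n)) → Fin (suc (slots (suc n)))
shift n zero    = zero
shift n (suc p) = suc (n ↑ʳ p)

pos : ∀ {n} → Fin n → Fin n → Fin (suc (slots n))
pos {suc n} zero    zero    = zero
pos {suc n} zero    (suc j) = suc (j ↑ˡ slots n)
pos {suc n} (suc i) zero    = suc (i ↑ˡ slots n)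
pos {suc n} (suc i) (suc j) = shift n (pos i j)

adj≡lookup-pos : ∀ {n} (H : Graph n) i j → adj H i j ≡ lookup (encode H) (pos i j)
adj≡lookup-pos {suc n} (v , g) zero    zero    = refl
adj≡lookup-pos {suc n} (v , g) zero    (suc j) = sym (lookup-++ˡ v _ j)
adj≡lookup-pos {suc n} (v , g) (suc i) zero    = sym (lookup-++ˡ v _ i)
adj≡lookup-pos {suc n} (v , g) (suc i) (suc j) with pos i j | adj≡lookup-pos g i j
... | zero  | e = e
... | suc p | e = trans e (sym (lookup-++ʳ v _ p))

adj-irrefl : ∀ {n} (H : Graph n) i → adj H i i ≡ false
adj-irrefl {suc n} (v , g) zero    = refl
adj-irrefl {suc n} (v , g) (suc i) = adj-irrefl g i

adj-sym : ∀ {n} (H : Graph n) i j → adj H i j ≡ adj H j i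
adj-sym {suc n} (v , g) zero    zero    = refl
adj-sym {suc n} (v , g) zero    (suc j) = refl
adj-sym {suc n} (v , g) (suc i) zero    = refl
adj-sym {suc n} (v , g) (suc i) (suc j) = adj-sym g i j

SamePair : ∀ {n} → Fin n × Fin n → Fin n × Fin n → Set
SamePair (x , y) (u , v) = (x ≡ u × y ≡ v) ⊎ (x ≡ v × y ≡ u)

unpos : ∀ {n} → Fin (slots n) → Fin n × Fin n
unpos {suc n} p = [ (λ j → zero , suc j) , Product.map suc suc ∘ unpos ]′ (splitAt n p)

pos-diag : ∀ {n} (x : Fin n) → pos x x ≡ zero
pos-diag {suc n} zero    = refl
pos-diag {suc n} (suc x) rewrite pos-diag x = refl

unpos-↑ˡ : ∀ {n} (j : Fin n) → unpos {suc n} (j ↑ˡ slots n) ≡ (zero , suc j)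
unpos-↑ˡ {n} j rewrite splitAt-↑ˡ n j (slots n) = refl

unpos-↑ʳ : ∀ {n} (p : Fin (slots n)) → unpos {suc n} (n ↑ʳ p) ≡ Product.map suc suc (unpos p)
unpos-↑ʳ {n} p rewrite splitAt-↑ʳ n (slots n) p = refl

pos-decode : ∀ {n} (x y : Fin n) → x ≢ y → ∃ λ p → pos x y ≡ suc p × SamePair (x , y) (unpos p)
pos-decode {suc n} zero    zero    x≢y = ⊥-elim (x≢y refl)
pos-decode {suc n} zero    (suc j) _ =
  j ↑ˡ slots n , refl , subst (SamePair _) (sym (unpos-↑ˡ j)) (inj₁ (refl , refl))
pos-decode {suc n} (suc i) zero    _ =
  i ↑ˡ slots n , refl , subst (SamePair _) (sym (unpos-↑ˡ i)) (inj₂ (refl , refl))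
pos-decode {suc n} (suc i) (suc j) x≢y with pos-decode i j (x≢y ∘ cong suc)
... | p , e , same rewrite e = n ↑ʳ p , refl , subst (SamePair _) (sym (unpos-↑ʳ p)) (lift same)
  where lift : SamePair (i , j) (unpos p) → SamePair (suc i , suc j) (Product.map suc suc (unpos p))
        lift (inj₁ (refl , refl)) = inj₁ (refl , refl)
        lift (inj₂ (refl , refl)) = inj₂ (refl , refl)

pos-injective : ∀ {n} {x y x′ y′ : Fin n} → x ≢ y → pos x y ≡ pos x′ y′ → SamePair (x , y) (x′ , y′)
pos-injective {x = x} {y} {x′} {y′} x≢y e with pos-decode x y x≢y | x′ ≟ y′
... | p , e₁ , _ | yes refl = ⊥-elim (0≢1+n (trans (sym (pos-diag x′)) (trans (sym e) e₁)))
... | p , e₁ , s₁ | no x′≢y′ with pos-decode x′ y′ x′≢y′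
...   | p′ , e₂ , s₂ with suc-injective (trans (sym e₁) (trans e e₂))
...     | refl = join s₁ s₂
  where join : ∀ {u} → SamePair (x , y) u → SamePair (x′ , y′) u → SamePair (x , y) (x′ , y′)
        join (inj₁ (refl , refl)) (inj₁ (refl , refl)) = inj₁ (refl , refl)
        join (inj₁ (refl , refl)) (inj₂ (refl , refl)) = inj₂ (refl , refl)
        join (inj₂ (refl , refl)) (inj₁ (refl , refl)) = inj₂ (refl , refl)
        join (inj₂ (refl , refl)) (inj₂ (refl , refl)) = inj₁ (refl , refl)

length-cartesianProduct : ∀ {A B : Set} (xs : List A) (ys : List B) →
  length (cartesianProduct xs ys) ≡ length xs * length ys
length-cartesianProduct []       ys = refl
length-cartesianProduct (x ∷ xs) ys =
  trans (length-++ (map (x ,_) ys)) (cong₂ _+_ (length-map (x ,_) ys) (length-cartesianProduct xs ys))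

allPairs : ∀ n → List (Fin n × Fin n)
allPairs n = cartesianProduct (allFin n) (allFin n)

length-allPairs : ∀ n → length (allPairs n) ≡ n * n
length-allPairs n = trans (length-cartesianProduct (allFin n) (allFin n))
  (cong₂ _*_ (length-tabulate {n = n} (λ i → i)) (length-tabulate {n = n} (λ i → i)))

distinct? : ∀ {m} (ij : Fin m × Fin m) → Dec (proj₁ ij ≢ proj₂ ij)
distinct? (i , j) = ¬? (i ≟ j)

offDiagonal : ∀ m → List (Fin m × Fin m)
offDiagonal m = filter distinct? (allPairs m)

copyEntry : ∀ {m n} → Graph m → (Fin m → Fin n) → Fin m × Fin m → Fin (suc (slots n)) × Bool
copyEntry G ψ (i , j) = pos (ψ i) (ψ j) , adj G i j

copyConstraint : ∀ {m n} → Graph m → (Fin m → Fin n) → Constraint (suc (slots n))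
copyConstraint {m} G ψ = assignment (map (copyEntry G ψ) (offDiagonal m))

size-copyConstraint : ∀ {m n} (G : Graph m) (ψ : Fin m → Fin n) → size (copyConstraint G ψ) ≤ m * m
size-copyConstraint {m} G ψ = begin
  size (copyConstraint G ψ)                   ≤⟨ size-assignment (map (copyEntry G ψ) (offDiagonal m)) ⟩
  length (map (copyEntry G ψ) (offDiagonal m)) ≡⟨ length-map (copyEntry G ψ) (offDiagonal m) ⟩
  length (offDiagonal m)                      ≤⟨ length-filter distinct? (allPairs m) ⟩
  length (allPairs m)                         ≡⟨ length-allPairs m ⟩
  m * m                                       ∎
  where open ≤-Reasoning

copyConstraint-fixed : ∀ {m n} (G : Graph m) (ψ : Fin m → Fin n) {p b} → copyConstraint G ψ p ≡ just b →
  ∃ λ i → ∃ λ j → i ≢ j × pos (ψ i) (ψ j) ≡ p × adj G i j ≡ b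
copyConstraint-fixed {m} G ψ fixed
  with ∈-map⁻ (copyEntry G ψ) (assignment-sound (map (copyEntry G ψ) (offDiagonal m)) fixed)
... | (i , j) , ij∈ , refl = i , j , proj₂ (∈-filter⁻ distinct? {xs = allPairs m} ij∈) , refl , refl

module _ {m n} (G : Graph m) {ψ : Fin m → Fin n} (ψ-injective : Injective _≡_ _≡_ ψ) where

  copyConstraint-pos : ∀ {i j} → i ≢ j → copyConstraint G ψ (pos (ψ i) (ψ j)) ≡ just (adj G i j)
  copyConstraint-pos {i} {j} i≢j with assignment-defined (map (copyEntry G ψ) (offDiagonal m))
      (∈-map⁺ (copyEntry G ψ) (∈-filter⁺ distinct? (∈-cartesianProduct⁺ (∈-allFin i) (∈-allFin j)) i≢j))
  ... | b , fixed with copyConstraint-fixed G ψ fixed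
  ...   | i′ , j′ , i′≢j′ , same-pos , refl =
    trans fixed (cong just (same-adj (pos-injective (i′≢j′ ∘ ψ-injective) same-pos)))
    where
    same-adj : SamePair (ψ i′ , ψ j′) (ψ i , ψ j) → adj G i′ j′ ≡ adj G i j
    same-adj (inj₁ (e₁ , e₂)) = cong₂ (adj G) (ψ-injective e₁) (ψ-injective e₂)
    same-adj (inj₂ (e₁ , e₂)) = trans (cong₂ (adj G) (ψ-injective e₁) (ψ-injective e₂)) (adj-sym G j i)

  matches-copyConstraint : ∀ (H : Graph n) → matches (copyConstraint G ψ) (encode H) ≡ true →
    ∀ i j → adj H (ψ i) (ψ j) ≡ adj G i j
  matches-copyConstraint H match i j with i ≟ j
  ... | yes refl = trans (adj-irrefl H (ψ i)) (sym (adj-irrefl G i))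
  ... | no i≢j = trans (adj≡lookup-pos H (ψ i) (ψ j))
                       (matches-sound (copyConstraint G ψ) (encode H) match (copyConstraint-pos i≢j))

ShareNoEdge : ∀ {m n} → (Fin m → Fin n) → (Fin m → Fin n) → Set
ShareNoEdge ψ ψ′ = ∀ {i j i′ j′} → i ≢ j → ψ i ≡ ψ′ i′ → ψ j ≢ ψ′ j′

copyConstraints-disjoint : ∀ {m n} (G : Graph m) {ψ ψ′ : Fin m → Fin n} → Injective _≡_ _≡_ ψ →
  ShareNoEdge ψ ψ′ → Disjoint (copyConstraint G ψ) (copyConstraint G ψ′)
copyConstraints-disjoint G {ψ} {ψ′} ψ-injective no-shared p
  with copyConstraint G ψ p in fixed | copyConstraint G ψ′ p in fixed′
... | nothing | _       = inj₁ refl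
... | just _  | nothing = inj₂ refl
... | just _  | just _
  with copyConstraint-fixed G ψ fixed | copyConstraint-fixed G ψ′ fixed′
...   | i , j , i≢j , refl , _ | i′ , j′ , _ , same-pos , _
  with pos-injective (i≢j ∘ ψ-injective) (sym same-pos)
...     | inj₁ (e₁ , e₂) = ⊥-elim (no-shared i≢j e₁ e₂)
...     | inj₂ (e₁ , e₂) = ⊥-elim (no-shared i≢j e₁ e₂)

-- Edge-disjoint copies along lines

lines-meet-once-< : ∀ {a b a′ b′ i j} → i < j →
  a + i * b ≡ a′ + i * b′ → a + j * b ≡ a′ + j * b′ → a ≡ a′ × b ≡ b′
lines-meet-once-< {a} {b} {a′} {b′} {i} i<j eᵢ eⱼ with m≤n⇒∃[o]m+o≡n i<j
... | d , refl = a≡a′ , b≡b′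
  where
  expand : ∀ a b i d → a + (suc i + d) * b ≡ (a + i * b) + suc d * b
  expand = solve-∀
  b≡b′ : b ≡ b′
  b≡b′ = *-cancelˡ-≡ b b′ (suc d) (+-cancelˡ-≡ (a′ + i * b′) _ _
    (trans (cong (_+ suc d * b) (sym eᵢ)) (trans (sym (expand a b i d)) (trans eⱼ (expand a′ b′ i d)))))
  a≡a′ : a ≡ a′
  a≡a′ = +-cancelʳ-≡ (i * b) a a′ (trans eᵢ (cong (λ z → a′ + i * z) (sym b≡b′)))

lines-meet-once : ∀ {a b a′ b′ i j} → i ≢ j →
  a + i * b ≡ a′ + i * b′ → a + j * b ≡ a′ + j * b′ → a ≡ a′ × b ≡ b′
lines-meet-once {i = i} {j} i≢j eᵢ eⱼ with <-cmp i j
... | tri< i<j _ _ = lines-meet-once-< i<j eᵢ eⱼ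
... | tri≈ _ i≡j _ = ⊥-elim (i≢j i≡j)
... | tri> _ _ j<i = lines-meet-once-< j<i eⱼ eᵢ

-- σ is cut into m blocks of m * c slots; copy (a , b) places its vertex i at slot a + i * b of block i.
module BlockDesign {m n k c} (G : Graph m) (σ : Vec (Fin n) k) (m*m*c≤k : m * (m * c) ≤ k) where

  line : Fin m → Fin c × Fin c → Fin (m * c)
  line i (a , b) = fromℕ< (line< (toℕ<n a) (toℕ<n b) (toℕ<n i))
    where
    line< : ∀ {a b i} → a < c → b < c → i < m → a + i * b < m * c
    line< {i = i} a<c b<c i<m = <-≤-trans (+-mono-<-≤ a<c (*-monoʳ-≤ i (<⇒≤ b<c))) (*-monoˡ-≤ c i<m)

  toℕ-line : ∀ i a b → toℕ (line i (a , b)) ≡ toℕ a + toℕ i * toℕ b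
  toℕ-line i a b = toℕ-fromℕ< _

  toℕ-line-≡ : ∀ i {a b a′ b′} → line i (a , b) ≡ line i (a′ , b′) →
    toℕ a + toℕ i * toℕ b ≡ toℕ a′ + toℕ i * toℕ b′
  toℕ-line-≡ i {a} {b} {a′} {b′} e = trans (sym (toℕ-line i a b)) (trans (cong toℕ e) (toℕ-line i a′ b′))

  slot : Fin m → Fin c × Fin c → Fin k
  slot i ab = inject≤ (combine i (line i ab)) m*m*c≤k

  slot-injective : ∀ {i i′ ab ab′} → slot i ab ≡ slot i′ ab′ → i ≡ i′ × line i ab ≡ line i′ ab′
  slot-injective {i} {i′} {ab} {ab′} e = ,-injective (begin
    (i , line i ab)                        ≡⟨ remQuot-combine i (line i ab) ⟨
    remQuot (m * c) (combine i (line i ab))   ≡⟨ cong (remQuot (m * c)) (inject≤-injective _ _ _ _ e) ⟩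
    remQuot (m * c) (combine i′ (line i′ ab′)) ≡⟨ remQuot-combine i′ (line i′ ab′) ⟩
    (i′ , line i′ ab′)                     ∎)
    where open ≡-Reasoning

  copy : Fin c × Fin c → Fin m → Fin n
  copy ab i = lookup σ (slot i ab)

  blockConstraints : List (Constraint (suc (slots n)))
  blockConstraints = map (copyConstraint G ∘ copy) (allPairs c)

  length-blockConstraints : length blockConstraints ≡ c * c
  length-blockConstraints = trans (length-map _ (allPairs c)) (length-allPairs c)

  size-blockConstraints : All (λ d → size d ≤ m * m) blockConstraints
  size-blockConstraints = All.map⁺ (All.universal (λ ab → size-copyConstraint G (copy ab)) (allPairs c))

  module _ (σ-injective : Injective _≡_ _≡_ (lookup σ)) where

    copy-injective : ∀ ab → Injective _≡_ _≡_ (copy ab)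
    copy-injective ab = proj₁ ∘ slot-injective ∘ σ-injective

    copies-share-no-edge : ∀ {ab ab′} → ab ≢ ab′ → ShareNoEdge (copy ab) (copy ab′)
    copies-share-no-edge {a , b} {a′ , b′} ab≢ab′ {i} {j} i≢j eᵢ eⱼ
      with slot-injective (σ-injective eᵢ) | slot-injective (σ-injective eⱼ)
    ... | refl , lᵢ | refl , lⱼ
      with lines-meet-once (i≢j ∘ toℕ-injective) (toℕ-line-≡ i lᵢ) (toℕ-line-≡ j lⱼ)
    ...   | a≡a′ , b≡b′ = ab≢ab′ (cong₂ _,_ (toℕ-injective a≡a′) (toℕ-injective b≡b′))

    blockConstraints-disjoint : AllPairs Disjoint blockConstraints
    blockConstraints-disjoint = AllPairs.map⁺ (AllPairs.map
      (λ ab≢ab′ → copyConstraints-disjoint G (copy-injective _) (copies-share-no-edge ab≢ab′))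
      (Unique.cartesianProduct⁺ (Unique.allFin⁺ c) (Unique.allFin⁺ c)))

    count-avoidsBlockConstraints : count (avoidsAll blockConstraints) * (2 ^ suc (m * m)) ^ (c * c)
                                   ≤ 2 ^ suc (slots n) * (2 ^ suc (m * m) ∸ 1) ^ (c * c)
    count-avoidsBlockConstraints = subst
      (λ t → count (avoidsAll blockConstraints) * (2 ^ suc (m * m)) ^ t
             ≤ 2 ^ suc (slots n) * (2 ^ suc (m * m) ∸ 1) ^ t)
      length-blockConstraints
      (count-avoidsAll (suc (m * m)) blockConstraints blockConstraints-disjoint
        (All.map (λ s≤mm → ≤-trans s≤mm (n≤1+n (m * m))) size-blockConstraints))

-- Union bound

anyFin : ∀ {n} → (Fin n → Bool) → Bool
anyFin {zero}  f = false
anyFin {suc n} f = f zero ∨ anyFin (f ∘ suc)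

anyVec : ∀ {n} k → (Vec (Fin n) k → Bool) → Bool
anyVec zero    Q = Q []
anyVec (suc k) Q = anyFin λ a → anyVec k (Q ∘ (a ∷_))

anyFin-intro : ∀ {n} (f : Fin n → Bool) a → f a ≡ true → anyFin f ≡ true
anyFin-intro f zero    fa rewrite fa = refl
anyFin-intro f (suc a) fa with f zero
... | true  = refl
... | false = anyFin-intro (f ∘ suc) a fa

anyVec-intro : ∀ {n} k (Q : Vec (Fin n) k → Bool) σ → Q σ ≡ true → anyVec k Q ≡ true
anyVec-intro zero    Q []      Qσ = Qσ
anyVec-intro (suc k) Q (a ∷ σ) Qσ = anyFin-intro _ a (anyVec-intro k (Q ∘ (a ∷_)) σ Qσ)

count-anyFin : ∀ {D n} (Q : Fin n → Vec Bool D → Bool) W V → (∀ a → count (Q a) * W ≤ V) →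
  count (λ x → anyFin (λ a → Q a x)) * W ≤ n * V
count-anyFin {D} {zero}  Q W V bound = ≤-reflexive (cong (_* W) (count-false {D}))
count-anyFin {D} {suc n} Q W V bound = begin
  count (λ x → Q zero x ∨ rest x) * W         ≤⟨ *-monoˡ-≤ W (count-∨ (Q zero) rest) ⟩
  (count (Q zero) + count rest) * W           ≡⟨ *-distribʳ-+ W (count (Q zero)) (count rest) ⟩
  count (Q zero) * W + count rest * W         ≤⟨ +-mono-≤ (bound zero) (count-anyFin (Q ∘ suc) W V (bound ∘ suc)) ⟩
  V + n * V                                   ∎
  where
  open ≤-Reasoning
  rest : Vec Bool D → Bool
  rest x = anyFin (λ a → Q (suc a) x)

count-anyVec : ∀ {D n} k (Q : Vec (Fin n) k → Vec Bool D → Bool) W V → (∀ σ → count (Q σ) * W ≤ V) →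
  count (λ x → anyVec k (λ σ → Q σ x)) * W ≤ n ^ k * V
count-anyVec zero    Q W V bound = ≤-trans (bound []) (≤-reflexive (sym (+-identityʳ V)))
count-anyVec {n = n} (suc k) Q W V bound = ≤-trans
  (count-anyFin (λ a x → anyVec k (λ σ → Q (a ∷ σ) x)) W (n ^ k * V)
                λ a → count-anyVec k (Q ∘ (a ∷_)) W V (bound ∘ (a ∷_)))
  (≤-reflexive (sym (*-assoc n (n ^ k) V)))

enumerate : ∀ {n} (S : Subset n) →
  ∃ λ (σ : Vec (Fin n) ∣ S ∣) → Injective _≡_ _≡_ (lookup σ) × (∀ i → lookup σ i ∈ₛ S)
enumerate []            = [] , (λ { {()} }) , λ ()
enumerate (inside ∷ S)  with enumerate S
... | σ , σ-injective , σ⊆S = zero ∷ Vec.map suc σ , injective , ⊆S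
  where
  injective : Injective _≡_ _≡_ (lookup (zero ∷ Vec.map suc σ))
  injective {zero}  {zero}  _ = refl
  injective {zero}  {suc j} e with trans e (lookup-map j suc σ)
  ... | ()
  injective {suc i} {zero}  e with trans (sym (lookup-map i suc σ)) e
  ... | ()
  injective {suc i} {suc j} e =
    cong suc (σ-injective (suc-injective (trans (sym (lookup-map i suc σ)) (trans e (lookup-map j suc σ)))))
  ⊆S : ∀ i → lookup (zero ∷ Vec.map suc σ) i ∈ₛ inside ∷ S
  ⊆S zero    = Vec.here
  ⊆S (suc i) = subst (_∈ₛ inside ∷ S) (sym (lookup-map i suc σ)) (Vec.there (σ⊆S i))
enumerate (outside ∷ S) with enumerate S
... | σ , σ-injective , σ⊆S = Vec.map suc σ , injective , ⊆S
  where
  injective : Injective _≡_ _≡_ (lookup (Vec.map suc σ))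
  injective {i} {j} e =
    σ-injective (suc-injective (trans (sym (lookup-map i suc σ)) (trans e (lookup-map j suc σ))))
  ⊆S : ∀ i → lookup (Vec.map suc σ) i ∈ₛ outside ∷ S
  ⊆S i = subst (_∈ₛ outside ∷ S) (sym (lookup-map i suc σ)) (Vec.there (σ⊆S i))

enumerate-sized : ∀ {n k} (S : Subset n) → ∣ S ∣ ≡ k →
  ∃ λ (σ : Vec (Fin n) k) → Injective _≡_ _≡_ (lookup σ) × (∀ i → lookup σ i ∈ₛ S)
enumerate-sized S refl = enumerate S

^-distribʳ-* : ∀ a b q → (a * b) ^ q ≡ a ^ q * b ^ q
^-distribʳ-* a b zero    = refl
^-distribʳ-* a b (suc q) =
  trans (cong (a * b *_) (^-distribʳ-* a b q)) ([m*n]*[o*p]≡[m*o]*[n*p] a b (a ^ q) (b ^ q))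

binomial-lower : ∀ w j → w ^ suc j + suc j * w ^ j ≤ suc w ^ suc j
binomial-lower w zero    = ≤-reflexive (base w)
  where base : ∀ w → w * 1 + 1 * 1 ≡ suc w * 1
        base = solve-∀
binomial-lower w (suc j) = begin
  w * P + suc (suc j) * P                    ≤⟨ m≤m+n _ (suc j * w ^ j) ⟩
  w * P + suc (suc j) * P + suc j * w ^ j    ≡⟨ expand w j (w ^ j) ⟩
  suc w * (P + suc j * w ^ j)                ≤⟨ *-monoʳ-≤ (suc w) (binomial-lower w j) ⟩
  suc w * suc w ^ suc j                      ∎
  where
  open ≤-Reasoning
  P = w ^ suc j
  expand : ∀ w j x → w * (w * x) + suc (suc j) * (w * x) + suc j * x ≡ suc w * (w * x + suc j * x)
  expand = solve-∀

2*w^w≤[1+w]^w : ∀ j → 2 * suc j ^ suc j ≤ suc (suc j) ^ suc j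
2*w^w≤[1+w]^w j = ≤-trans (≤-reflexive (cong (x +_) (+-identityʳ x))) (binomial-lower (suc j) j)
  where x = suc j ^ suc j

bernoulli-pow : ∀ M q t → 2 ≤ M → (M ∸ 1) * q ≤ t → (M ∸ 1) ^ t * 2 ^ q ≤ M ^ t
bernoulli-pow (suc zero)    q t (s≤s ()) _
bernoulli-pow (suc (suc j)) q t _ wq≤t with m≤n⇒∃[o]m+o≡n wq≤t
... | d , refl = begin
  w ^ (w * q + d) * 2 ^ q           ≡⟨ cong (_* 2 ^ q) (^-distribˡ-+-* w (w * q) d) ⟩
  w ^ (w * q) * w ^ d * 2 ^ q       ≡⟨ cong (λ z → z * w ^ d * 2 ^ q) (^-*-assoc w w q) ⟨
  (w ^ w) ^ q * w ^ d * 2 ^ q       ≡⟨ rearrange ((w ^ w) ^ q) (w ^ d) (2 ^ q) ⟩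
  2 ^ q * (w ^ w) ^ q * w ^ d       ≡⟨ cong (_* w ^ d) (^-distribʳ-* 2 (w ^ w) q) ⟨
  (2 * w ^ w) ^ q * w ^ d           ≤⟨ *-mono-≤ (^-monoˡ-≤ q (2*w^w≤[1+w]^w j)) (^-monoˡ-≤ d (n≤1+n w)) ⟩
  (suc w ^ w) ^ q * suc w ^ d       ≡⟨ cong (_* suc w ^ d) (^-*-assoc (suc w) w q) ⟩
  suc w ^ (w * q) * suc w ^ d       ≡⟨ ^-distribˡ-+-* (suc w) (w * q) d ⟨
  suc w ^ (w * q + d)               ∎
  where
  open ≤-Reasoning
  w = suc j
  rearrange : ∀ a b c → a * b * c ≡ c * a * b
  rearrange = solve-∀

⌊log₂⌋-bracket : ∀ n → 1 ≤ n → ∃ λ ℓ → 2 ^ ℓ ≤ n × n < 2 ^ suc ℓ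
⌊log₂⌋-bracket (suc zero)    _ = 0 , s≤s z≤n , s≤s (s≤s z≤n)
⌊log₂⌋-bracket (suc (suc n)) _ with ⌊log₂⌋-bracket (suc n) (s≤s z≤n)
... | ℓ , lo , hi with suc (suc n) <? 2 ^ suc ℓ
...   | yes below = ℓ , m≤n⇒m≤1+n lo , below
...   | no  ¬below = suc ℓ , ≤-reflexive 2^[1+ℓ]≡n ,
                     subst (_< 2 ^ suc (suc ℓ)) 2^[1+ℓ]≡n (^-monoʳ-< 2 (s≤s (s≤s z≤n)) (n<1+n (suc ℓ)))
  where 2^[1+ℓ]≡n : 2 ^ suc ℓ ≡ suc (suc n)
        2^[1+ℓ]≡n = ≤-antisym (≮⇒≥ ¬below) hi

f-lower : ∀ N {n ℓ} → 2 ^ ℓ ≤ n → ℓ * N ≤ f N n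
f-lower N {n} {ℓ} 2^ℓ≤n = begin
  ℓ * N                   ≡⟨ ⌈log₂2^n⌉≡n (ℓ * N) ⟨
  ⌈log₂ (2 ^ (ℓ * N)) ⌉   ≤⟨ ⌈log₂⌉-mono-≤ (subst (_≤ n ^ N) (^-*-assoc 2 ℓ N) (^-monoˡ-≤ N 2^ℓ≤n)) ⟩
  f N n                   ∎
  where open ≤-Reasoning

m<[1+m/n]*n : ∀ m n .{{_ : NonZero n}} → m < suc (m / n) * n
m<[1+m/n]*n m n = begin-strict
  m                   ≡⟨ m≡m%n+[m/n]*n m n ⟩
  m % n + m / n * n   <⟨ +-monoˡ-< (m / n * n) (m%n<n m n) ⟩
  n + m / n * n       ∎
  where open ≤-Reasoning

m*n≤o⇒m≤o/n : ∀ {m o} n .{{_ : NonZero n}} → m * n ≤ o → m ≤ o / n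
m*n≤o⇒m≤o/n {m} n le = ≤-trans (≤-reflexive (sym (m*n/n≡m m n))) (/-monoˡ-≤ n le)

exponent-bound : ∀ {c K ℓ k} → 1 ≤ c → 1 ≤ ℓ → k < suc c * suc K →
  (k + 2 * k) * suc ℓ + 2 ≤ 14 * c * suc K * ℓ
exponent-bound {suc c} {K} {suc ℓ} {k} _ _ k< = begin
  (k + 2 * k) * suc (suc ℓ) + 2  ≤⟨ +-monoˡ-≤ 2 (*-monoˡ-≤ (suc (suc ℓ)) (+-mono-≤ k≤X (*-monoʳ-≤ 2 k≤X))) ⟩
  (X + 2 * X) * suc (suc ℓ) + 2  ≤⟨ m≤m+n _ slack ⟩
  (X + 2 * X) * suc (suc ℓ) + 2 + slack ≡⟨ identity c K ℓ ⟩
  14 * suc c * suc K * suc ℓ     ∎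
  where
  open ≤-Reasoning
  Y = suc c * suc K
  X = 2 * Y
  slack = 8 * Y * ℓ + 2 * (c * K + c + K)
  k≤X : k ≤ X
  k≤X = ≤-trans (<⇒≤ k<)
          (≤-trans (+-monoˡ-≤ Y (m≤n*m (suc K) (suc c))) (≤-reflexive (cong (Y +_) (sym (+-identityʳ Y)))))
  identity : ∀ c K ℓ → (2 * (suc c * suc K) + 2 * (2 * (suc c * suc K))) * suc (suc ℓ) + 2
                       + (8 * (suc c * suc K) * ℓ + 2 * (c * K + c + K)) ≡ 14 * suc c * suc K * suc ℓ
  identity = solve-∀

2*n^e<2^[e*[1+ℓ]+2] : ∀ {n ℓ} e → n < 2 ^ suc ℓ → 2 * n ^ e < 2 ^ (e * suc ℓ + 2)
2*n^e<2^[e*[1+ℓ]+2] {n} {ℓ} e n<2^[1+ℓ] = begin-strict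
  2 * n ^ e                  ≤⟨ *-monoʳ-≤ 2 (^-monoˡ-≤ e (<⇒≤ n<2^[1+ℓ])) ⟩
  2 * (2 ^ suc ℓ) ^ e        ≡⟨ cong (2 *_) (^-*-assoc 2 (suc ℓ) e) ⟩
  2 ^ suc (suc ℓ * e)        <⟨ ^-monoʳ-< 2 (s≤s (s≤s z≤n)) (n<1+n (suc (suc ℓ * e))) ⟩
  2 ^ (2 + suc ℓ * e)        ≡⟨ cong (2 ^_) (trans (+-comm 2 (suc ℓ * e)) (cong (_+ 2) (*-comm (suc ℓ) e))) ⟩
  2 ^ (e * suc ℓ + 2)        ∎
  where open ≤-Reasoning

count-ratio-bound : ∀ {ℓ P A B T E W} → ℓ ≤ P → P * T ≤ A * (2 ^ suc E * W) → 2 * (A * B) * W < T →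
  ℓ * B < 2 ^ E
count-ratio-bound {ℓ} {P} {A} {B} {T} {E} {W} ℓ≤P PT≤ AB< = *-cancelʳ-< T (ℓ * B) (2 ^ E) (begin-strict
  ℓ * B * T                ≤⟨ *-monoˡ-≤ T (*-monoˡ-≤ B ℓ≤P) ⟩
  P * B * T                ≡⟨ xy∙z≈xz∙y P B T ⟩
  P * T * B                ≤⟨ *-monoˡ-≤ B PT≤ ⟩
  A * (2 ^ suc E * W) * B  ≡⟨ rearrange A (2 ^ E) W B ⟩
  2 ^ E * (2 * (A * B) * W) <⟨ *-monoʳ-< (2 ^ E) {{m^n≢0 2 E}} AB< ⟩
  2 ^ E * T                ∎)
  where
  open ≤-Reasoning
  rearrange : ∀ a x w b → a * (2 * x * w) * b ≡ x * (2 * (a * b) * w)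
  rearrange = solve-∀

-- A copy of G fixes at most m * m bits; the + 1 in K keeps M ≥ 2, as Bernoulli's inequality needs.
module Parameters (m : ℕ) where

  K : ℕ
  K = suc (m * m)

  M : ℕ
  M = 2 ^ K

  N′ : ℕ
  N′ = 14 * M * K

  N : ℕ
  N = N′ * K

  1≤N′ : 1 ≤ N′
  1≤N′ = *-mono-≤ (*-mono-≤ {1} {14} (s≤s z≤n) (m^n>0 2 K)) (s≤s z≤n)

  2≤M : 2 ≤ M
  2≤M = *-monoʳ-≤ 2 (m^n>0 2 (m * m))

  -- With k = f N n and c = k / K: the n ^ k vertex sequences of the union bound, the n ^ (2 k)
  -- of the statement and the factor 2 of the dummy bit are beaten by (1 - 1/M) ^ (c * c).
  key : ∀ n → 2 ≤ n → let k = f N n; t = (k / K) * (k / K) in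
    2 * n ^ (k + 2 * k) * (M ∸ 1) ^ t < M ^ t
  key n 2≤n with ⌊log₂⌋-bracket n (≤-trans (s≤s z≤n) 2≤n)
  ... | zero    , _      , n<2        = contradiction 2≤n (<⇒≱ n<2)
  ... | suc ℓ′ , 2^ℓ≤n , n<2^[1+ℓ] = begin-strict
    2 * n ^ e * w ^ t   <⟨ *-monoˡ-< (w ^ t) {{m^n≢0 w t {{>-nonZero (∸-monoˡ-≤ 1 2≤M)}}}}
                                         (2*n^e<2^[e*[1+ℓ]+2] e n<2^[1+ℓ]) ⟩
    2 ^ q * w ^ t       ≡⟨ *-comm (2 ^ q) (w ^ t) ⟩
    w ^ t * 2 ^ q       ≤⟨ bernoulli-pow M q t 2≤M wq≤t ⟩
    M ^ t               ∎
    where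
    open ≤-Reasoning
    ℓ = suc ℓ′
    k = f N n
    c = k / K
    t = c * c
    e = k + 2 * k
    q = e * suc ℓ + 2
    w = M ∸ 1
    ℓN′≤c : ℓ * N′ ≤ c
    ℓN′≤c = m*n≤o⇒m≤o/n K (≤-trans (≤-reflexive (*-assoc ℓ N′ K)) (f-lower N {n} {ℓ} 2^ℓ≤n))
    1≤c : 1 ≤ c
    1≤c = ≤-trans (*-mono-≤ {1} {ℓ} (s≤s z≤n) 1≤N′) ℓN′≤c
    wq≤t : w * q ≤ t
    wq≤t = begin
      w * q                  ≤⟨ *-monoˡ-≤ q (m∸n≤m M 1) ⟩
      M * q                  ≤⟨ *-monoʳ-≤ M (exponent-bound 1≤c (s≤s z≤n) (m<[1+m/n]*n k K)) ⟩
      M * (14 * c * K * ℓ)   ≡⟨ rearrange M c K ℓ ⟩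
      c * (ℓ * N′)           ≤⟨ *-monoʳ-≤ c ℓN′≤c ⟩
      c * c                  ∎
      where rearrange : ∀ M c K ℓ → M * (14 * c * K * ℓ) ≡ c * (ℓ * (14 * M * K))
            rearrange = solve-∀

  m*[m*[k/K]]≤k : ∀ k → m * (m * (k / K)) ≤ k
  m*[m*[k/K]]≤k k = begin
    m * (m * (k / K)) ≡⟨ *-assoc m m (k / K) ⟨
    m * m * (k / K)   ≤⟨ *-monoˡ-≤ (k / K) (n≤1+n (m * m)) ⟩
    K * (k / K)       ≡⟨ *-comm K (k / K) ⟩
    k / K * K         ≤⟨ m/n*n≤m k K ⟩
    k                 ∎
    where open ≤-Reasoning

injective? : ∀ {n k} (σ : Vec (Fin n) k) → Dec (∀ i j → lookup σ i ≡ lookup σ j → i ≡ j)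
injective? σ = all? λ i → all? λ j → (lookup σ i ≟ lookup σ j) →-dec (i ≟ j)

module GFreeCount {m} (G : Graph m) (n k c : ℕ) (m*m*c≤k : m * (m * c) ≤ k) where

  module Copies (σ : Vec (Fin n) k) = BlockDesign {m} {n} {k} {c} G σ m*m*c≤k
  open Copies

  avoidsAllCopies : Vec (Fin n) k → Vec Bool (suc (slots n)) → Bool
  avoidsAllCopies σ x = does (injective? σ) ∧ avoidsAll (blockConstraints σ) x

  escapes : Vec Bool (suc (slots n)) → Bool
  escapes x = anyVec k λ σ → avoidsAllCopies σ x

  count-escapes : count escapes * (2 ^ suc (m * m)) ^ (c * c)
                  ≤ n ^ k * (2 ^ suc (slots n) * (2 ^ suc (m * m) ∸ 1) ^ (c * c))
  count-escapes = count-anyVec k avoidsAllCopies _ _ λ σ →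
    count-guard (injective? σ) (avoidsAll (blockConstraints σ)) λ σ-injective →
    count-avoidsBlockConstraints σ λ {i} {j} → σ-injective i j

  GFree⇒escapes : ∀ (H : Graph n) → HasGFreeInducedSubgraph G k H → escapes (encode H) ≡ true
  GFree⇒escapes H (S , ∣S∣≡k , no-copy) with enumerate-sized S ∣S∣≡k
  ... | σ , σ-injective , σ⊆S = anyVec-intro k _ σ (avoids (injective? σ))
    where
    no-match : ∀ ab → matches (copyConstraint G (copy σ ab)) (encode H) ≡ false
    no-match ab with matches (copyConstraint G (copy σ ab)) (encode H) in match
    ... | false = refl
    ... | true  = contradiction
      (copy σ ab , (λ {i} {j} → copy-injective σ σ-injective ab) , (λ i → σ⊆S (slot σ i ab)) ,
       matches-copyConstraint G (copy-injective σ σ-injective ab) H match) no-copy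
    avoids : (d : Dec (∀ i j → lookup σ i ≡ lookup σ j → i ≡ j)) →
      does d ∧ avoidsAll (blockConstraints σ) (encode H) ≡ true
    avoids (no ¬injective) = contradiction (λ i j → σ-injective) ¬injective
    avoids (yes _) = avoidsAll-intro _ (encode H) (All.map⁺ (All.universal no-match (allPairs c)))

  length≤count-escapes : ∀ (L : List (Graph n)) → Unique L → All (HasGFreeInducedSubgraph G k) L →
    length L ≤ count escapes
  length≤count-escapes L unique free = subst (_≤ count escapes) (length-map encode L)
    (length≤count escapes (map encode L) (Unique.map⁺ (λ {H} {H′} → encode-injective H H′) unique)
                  (All.map⁺ (All.map (λ {H} → GFree⇒escapes H) free)))

lemma4 : ∀ {m} (G : Graph m) →
    ∃ λ (N : ℕ) → ∃ λ (n₀ : ℕ) → ∀ (n : ℕ) → n ≥ n₀ →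
      ∀ (L : List (Graph n)) → Unique L → All (HasGFreeInducedSubgraph G (f N n)) L →
        length L * n ^ (2 * f N n) < 2 ^ (n C 2)
lemma4 {m} G = N , 2 , λ n 2≤n L unique free →
  let k = f N n
      t = (k / K) * (k / K)
      open GFreeCount G n k (k / K) (m*[m*[k/K]]≤k k)
  in subst (λ E → length L * n ^ (2 * k) < 2 ^ E) (slots≡C2 n)
       (count-ratio-bound {A = n ^ k} {B = n ^ (2 * k)} {T = M ^ t} {E = slots n} {W = (M ∸ 1) ^ t}
         (length≤count-escapes L unique free)
         count-escapes
         (subst (λ z → 2 * z * (M ∸ 1) ^ t < M ^ t) (^-distribˡ-+-* n k (2 * k)) (key n 2≤n)))
  where open Parameters m
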